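{- For every positive integer $n$, let $G_n$ be the set of words in $\{1,2\}^*_n$ with no two consecutive $2$'s, and let $$H=\{\omega=1^{m_0}2^{n_0}1^{m_1}2^{n_1}\cdots1^{m_d}2^{n_d} \mid m_0=m_d-1,\ m_i=m_{d-i}\text{ for }1\le i\le d-1\}.$$ Then $\Phi_2(G_n)=\Phi_1^{ -1}(G_n)=\Gamma(G_n)$, and $\Phi_1^{ -1}(\omega)=\Phi_2(\omega)$ for every $\omega\in H$.
   Context: $\{1,2\}^*_n$ is the set of words of length $n$ on $\{1,2\}$; $a^r$ denotes $r$ consecutive copies of the letter $a$. Every binary word with $d$ descents is written uniquely as $\omega=1^{m_0}2^{n_0}1^{m_1}2^{n_1}\cdots1^{m_d}2^{n_d}$ with $m_0,n_d\ge0$, $m_i>0$ for $1\le i\le d$ and $n_j>0$ for $0\le j\le d-1$ (this is the form used in the definition of $H$). On binary words, Foata's first fundamental transformation $\Phi_1$ (which coincides with Han's bijection there) satisfies $$\Phi_1^{ -1}(\omega)=1^{m_0}21^{m_1-1}2\cdots21^{m_d-1}2^{n_0-1}12^{n_1-1}\cdots2^{n_{d-1}-1}12^{n_d},$$ and Foata's second fundamental transformation $\Phi_2$ satisfies $$\Phi_2(\omega)=1^{m_d-1}21^{m_{d-1}-1}2\cdots1^{m_1-1}21^{m_0}2^{n_0-1}12^{n_1-1}1\cdots2^{n_{d-1}-1}12^{n_d}.$$ Steingrímsson's map $\phi$: for a permutation $\pi=\pi_1\cdots\pi_n$ of $[n]$ set $\pi_0=0$ and define $\phi(\pi)=f(1)\cdots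 f(n)$ by, for each $k=1,\dots,n$: (1) if some $m$ with $k<m\le n$ has $\pi_m<\pi_k$, set $f(\pi_{k+1})=\pi_k$; (2) if $\pi_k<\pi_m$ for all $k<m\le n$, set $f(\pi_{j+1})=\pi_k$ with $j$ the largest index in $\{0,\dots,k-1\}$ having $\pi_j<\pi_k$. The standardization of $\omega=a_1\cdots a_n$ is $\beta_\omega(1)\cdots\beta_\omega(n)$ with $\beta_\omega(i)=\#\{j:a_j<a_i\}+\#\{j\le i:a_j=a_i\}$. $\Gamma(\omega)=a_{j_1}\cdots a_{j_n}$, where $\phi(\beta_\omega(1)\cdots\beta_\omega(n))=f(1)\cdots f(n)$ and $j_i$ is the unique index with $\beta_\omega(j_i)=f(i)$. For a map $\Psi$ and set $S$, $\Psi(S)=\{\Psi(\omega):\omega\in S\}$. -}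

module Defs where

open import Data.Nat using (ℕ; zero; suc; _+_; _∸_; _<ᵇ_; _≡ᵇ_; _≤_)
open import Data.Bool using (Bool; true; false; if_then_else_)
open import Data.List using (List; []; _∷_; _++_; map; length; concatMap; reverse; upTo; replicate)
open import Data.Bool.ListAction using (any)
open import Data.Product using (_×_; _,_; proj₁; proj₂; ∃-syntax)
open import Relation.Binary.PropositionalEquality using (_≡_)
open import Relation.Nullary using (¬_)

data L : Set where
  one two : L

val : L → ℕ
val one = 1
val two = 2

Word : Set
Word = List L

-- The unique decomposition  ω = 1^{m_0} 2^{n_0} 1^{m_1} 2^{n_1} ⋯ 1^{m_d} 2^{n_d}
-- (m_0, n_d ≥ 0, m_i > 0 for 1 ≤ i ≤ d, n_j > 0 for 0 ≤ j ≤ d-1),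
-- returned as the (always nonempty) list [(m_0,n_0), …, (m_d,n_d)].

dec : Word → ℕ → ℕ → List (ℕ × ℕ)
dec []          m k       = (m , k) ∷ []
dec (one ∷ w)   m zero    = dec w (suc m) zero
dec (one ∷ w)   m (suc k) = (m , suc k) ∷ dec w 1 0
dec (two ∷ w)   m k       = dec w m (suc k)

decomp : Word → List (ℕ × ℕ)
decomp w = dec w 0 0

tailPart : List ℕ → Word
tailPart []             = []
tailPart (k ∷ [])       = replicate k two
tailPart (k ∷ k' ∷ ks)  = replicate (k ∸ 1) two ++ (one ∷ tailPart (k' ∷ ks))

-- Φ₁⁻¹(ω) = 1^{m_0} 2 1^{m_1-1} 2 ⋯ 2 1^{m_d-1} 2^{n_0-1} 1 2^{n_1-1} ⋯ 2^{n_{d-1}-1} 1 2^{n_d}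
Φ₁⁻¹ : Word → Word
Φ₁⁻¹ w with decomp w
... | []                  = []   -- impossible: decomp is never empty
... | (m₀ , n₀) ∷ rest    =
  replicate m₀ one
  ++ concatMap (λ m → two ∷ replicate (m ∸ 1) one) (map proj₁ rest)
  ++ tailPart (n₀ ∷ map proj₂ rest)

-- Φ₂(ω) = 1^{m_d-1} 2 1^{m_{d-1}-1} 2 ⋯ 1^{m_1-1} 2 1^{m_0} 2^{n_0-1} 1 ⋯ 2^{n_{d-1}-1} 1 2^{n_d}
Φ₂ : Word → Word
Φ₂ w with decomp w
... | []                  = []   -- impossible: decomp is never empty
... | (m₀ , n₀) ∷ rest    =
  concatMap (λ m → replicate (m ∸ 1) one ++ (two ∷ [])) (reverse (map proj₁ rest))
  ++ replicate m₀ one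
  ++ tailPart (n₀ ∷ map proj₂ rest)

-- 1-indexed access with the convention  at xs 0 = 0  (so π₀ = 0)
at : List ℕ → ℕ → ℕ
at xs zero = 0
at [] (suc k) = 0
at (x ∷ xs) (suc zero) = x
at (x ∷ xs) (suc (suc k)) = at xs (suc k)

lookupKey : {A : Set} → A → List (ℕ × A) → ℕ → A
lookupKey d [] i = d
lookupKey d ((k , a) ∷ ps) i = if k ≡ᵇ i then a else lookupKey d ps i

from : ℕ → ℕ → List ℕ
from a r = map (λ i → a + suc i) (upTo r)

oneTo : ℕ → List ℕ
oneTo n = from 0 n

-- largest j ∈ {0,…,s} with π_j < v  (returns 0 if none among 1..s; π₀ = 0)
lastBelow : List ℕ → ℕ → ℕ → ℕ
lastBelow π v zero    = 0
lastBelow π v (suc j) = if at π (suc j) <ᵇ v then suc j else lastBelow π v j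

-- for step k, the argument i at which f(i) := π_k is set
stepKey : List ℕ → ℕ → ℕ
stepKey π k =
  if any (λ m → at π m <ᵇ at π k) (from k (length π ∸ k))
  then at π (suc k)
  else at π (suc (lastBelow π (at π k) (k ∸ 1)))

φ : List ℕ → List ℕ
φ π = map (lookupKey 0 assignments) (oneTo (length π))
  where
  assignments : List (ℕ × ℕ)
  assignments = map (λ k → (stepKey π k , at π k)) (oneTo (length π))

count : (L → Bool) → Word → ℕ
count p [] = 0
count p (x ∷ xs) = if p x then suc (count p xs) else count p xs

letterAt : Word → ℕ → L
letterAt [] i = one
letterAt (x ∷ xs) zero = x
letterAt (x ∷ xs) (suc i) = letterAt xs i

take' : ℕ → Word → Word
take' zero xs = []
take' (suc n) [] = []
take' (suc n) (x ∷ xs) = x ∷ take' n xs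

β : Word → ℕ → ℕ
β ω i = count (λ b → val b <ᵇ val a) ω + count (λ b → val b ≡ᵇ val a) (take' i ω)
  where
  a : L
  a = letterAt ω (i ∸ 1)

standardize : Word → List ℕ
standardize ω = map (β ω) (oneTo (length ω))

-- Γ(ω) = a_{j_1} ⋯ a_{j_n}  where  φ(β_ω) = f(1)⋯f(n)  and  β_ω(j_i) = f(i)
Γ : Word → Word
Γ ω = map (lookupKey one table) (φ (standardize ω))
  where
  table : List (ℕ × L)
  table = map (λ j → (β ω j , letterAt ω (j ∸ 1))) (oneTo (length ω))

NoTwoTwos : Word → Set
NoTwoTwos ω = ¬ (∃[ xs ] ∃[ ys ] (ω ≡ xs ++ (two ∷ two ∷ ys)))

InG : ℕ → Word → Set
InG n ω = length ω ≡ n × NoTwoTwos ω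

InH : Word → Set
InH ω = (suc (m 0) ≡ m d) × (∀ i → 1 ≤ i → i ≤ d ∸ 1 → m i ≡ m (d ∸ i))
  where
  ms : List ℕ
  ms = map proj₁ (decomp ω)
  d : ℕ
  d = length ms ∸ 1
  m : ℕ → ℕ
  m i = at ms (suc i)

InImage : (Word → Word) → (Word → Set) → Word → Set
InImage Ψ S w = ∃[ u ] (S u × Ψ u ≡ w)

SameImage : (Word → Word) → (Word → Word) → (Word → Set) → Set
SameImage Ψ Ψ' S = ∀ w → (InImage Ψ S w → InImage Ψ' S w) × (InImage Ψ' S w → InImage Ψ S w)

module Submission where

-- Describe a decomposition [(m₀,n₀),…,(m_d,n_d)] by its run vector
-- r = (m₀, m₁-1, …, m_d-1).  Both transformations keep the same 2-part
-- 2^{n₀-1} 1 ⋯ 1 2^{n_d} and spell r as 1^{r₀} 2 1^{r₁} 2 ⋯ 2 1^{r_d}: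
-- Φ₁⁻¹ in the given order, Φ₂ in reverse order (Φ₁⁻¹-runs, Φ₂-runs).  Hence
--  * on H the run vector is a palindrome (runs-palindrome), so Φ₁⁻¹ = Φ₂ there;
--  * a word without factor 22 is gword c e = 1^{c₀} 2 1^{1+c₁} ⋯ 2 1^{1+c_d} 2^e
--    with e ≤ 1 and run vector c (gform-of); reversing c maps G_n onto itself
--    and exchanges Φ₁⁻¹ and Φ₂ (G-swap), so Φ₂(G_n) = Φ₁⁻¹(G_n);
--  * on such words Steingrímsson's map sends the standardized value of each
--    position to the key of its partner (a 2 and the 1 following it are
--    partners, every other position is its own), so Γ(u) is the word of left
--    neighbours of the 1's followed by the right contexts of the 2's
--    (Analysis.Γ≡AB); on gword c e this is 1^{c₀} 2 ⋯ 2 1^{c_d} 1^d 2^e = Φ₁⁻¹(u),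
--    so Γ = Φ₁⁻¹ pointwise on G_n.

open import Defs
open import Data.Nat
  using (ℕ; zero; suc; _+_; _∸_; _≤_; _<_; z≤n; s≤s; z<s; s<s; _<ᵇ_; _≤ᵇ_; _≡ᵇ_; _≤?_; _<?_)
open import Data.Nat.Properties
  using (+-comm; +-identityʳ; +-suc; suc-injective; m≤m+n; m<m+n; n<1+n; +-monoʳ-≤;
         m+n∸m≡n; m+[n∸m]≡n; ∸-monoˡ-≤; m∸n≢0⇒n<m; m<n⇒0<n∸m;
         ≤-reflexive; ≤-antisym; <-trans; ≤-<-trans; <⇒≤; <⇒≱; ≰⇒>; ≮⇒≥;
         <ᵇ⇒<; <⇒<ᵇ; ≤⇒≤ᵇ; ≡ᵇ⇒≡; ≡⇒≡ᵇ; <ᵇ-reflects-<; ≤ᵇ-reflects-≤)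
open import Data.Nat.ListAction using (sum)
open import Data.Nat.ListAction.Properties using (sum-↭)
open import Data.Nat.Tactic.RingSolver using (solve-∀)
open import Data.Bool using (Bool; true; false; T; if_then_else_)
open import Data.Bool.Properties using (T-≡; if-cong)
open import Data.Bool.ListAction using (any)
open import Data.List
  using (List; []; _∷_; _++_; _∷ʳ_; map; length; concatMap; reverse; replicate; applyUpTo; upTo)
open import Data.List.Properties
  using (++-assoc; ++-identityʳ; concatMap-map; reverse-map; unfold-reverse; reverse-involutive;
         length-reverse; length-map; length-++; length-replicate; length-applyUpTo; ∷-injectiveʳ;
         map-∘; map-upTo; map-applyUpTo)
open import Data.List.Relation.Binary.Permutation.Propositional.Properties using (↭-reverse)
open import Data.List.Relation.Unary.All using (All; _∷_)
open import Data.List.Relation.Unary.Any using (Any; here; there)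
import Data.List.Relation.Unary.All.Properties as All
import Data.List.Relation.Unary.Any.Properties as Any
open import Data.Product using (_×_; _,_; proj₁; proj₂; Σ)
open import Data.Sum using (_⊎_; inj₁; inj₂)
open import Data.Empty using (⊥-elim)
open import Function using (_∘_)
open import Function.Bundles using (Equivalence)
open import Relation.Nullary using (¬_; yes; no)
open import Relation.Nullary.Reflects using (ofʸ)
open import Relation.Binary.PropositionalEquality
open ≡-Reasoning

ones twos : ℕ → Word
ones k = replicate k one
twos k = replicate k two

row : Word → List ℕ → Word
row s []       = []
row s (c ∷ cs) = ones c ++ concatMap (λ k → s ++ ones k) cs

row-rotate : ∀ s k ks c →
  concatMap (λ k → ones k ++ s) (k ∷ ks) ++ ones c ≡ row s (k ∷ ks ∷ʳ c)
row-rotate s k [] c = begin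
  ((ones k ++ s) ++ []) ++ ones c  ≡⟨ cong (_++ ones c) (++-identityʳ (ones k ++ s)) ⟩
  (ones k ++ s) ++ ones c          ≡⟨ ++-assoc (ones k) s (ones c) ⟩
  ones k ++ (s ++ ones c)          ≡⟨ cong (ones k ++_) (sym (++-identityʳ (s ++ ones c))) ⟩
  ones k ++ ((s ++ ones c) ++ [])  ∎
row-rotate s k (k′ ∷ ks) c = begin
  ((ones k ++ s) ++ rest) ++ ones c      ≡⟨ ++-assoc (ones k ++ s) rest (ones c) ⟩
  (ones k ++ s) ++ (rest ++ ones c)      ≡⟨ cong ((ones k ++ s) ++_) (row-rotate s k′ ks c) ⟩
  (ones k ++ s) ++ row s (k′ ∷ ks ∷ʳ c)  ≡⟨ ++-assoc (ones k) s _ ⟩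
  ones k ++ (s ++ (ones k′ ++ tl))       ≡⟨ cong (ones k ++_) (sym (++-assoc s (ones k′) tl)) ⟩
  ones k ++ ((s ++ ones k′) ++ tl)       ∎
  where
  rest = concatMap (λ k → ones k ++ s) (k′ ∷ ks)
  tl   = concatMap (λ k → s ++ ones k) (ks ∷ʳ c)

row-∷ʳ : ∀ s ks c → concatMap (λ k → ones k ++ s) ks ++ ones c ≡ row s (ks ∷ʳ c)
row-∷ʳ s []       c = sym (++-identityʳ (ones c))
row-∷ʳ s (k ∷ ks) c = row-rotate s k ks c

spell : List ℕ → Word → Word
spell r t = row (two ∷ []) r ++ t

runs : List (ℕ × ℕ) → List ℕ
runs []               = []
runs ((m₀ , _) ∷ rest) = m₀ ∷ map (_∸ 1) (map proj₁ rest)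

Φ₁⁻¹-runs : ∀ ω → Φ₁⁻¹ ω ≡ spell (runs (decomp ω)) (tailPart (map proj₂ (decomp ω)))
Φ₁⁻¹-runs ω with decomp ω
... | []                = refl
... | (m₀ , n₀) ∷ rest = begin
  ones m₀ ++ concatMap (λ m → two ∷ ones (m ∸ 1)) ms ++ t₂
    ≡⟨ cong (λ x → ones m₀ ++ x ++ t₂) (sym (concatMap-map (λ k → two ∷ ones k) (_∸ 1) ms)) ⟩
  ones m₀ ++ concatMap (λ k → two ∷ ones k) (map (_∸ 1) ms) ++ t₂
    ≡⟨ sym (++-assoc (ones m₀) _ t₂) ⟩
  spell (m₀ ∷ map (_∸ 1) ms) t₂ ∎
  where
  ms = map proj₁ rest
  t₂ = tailPart (n₀ ∷ map proj₂ rest)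

Φ₂-runs : ∀ ω → Φ₂ ω ≡ spell (reverse (runs (decomp ω))) (tailPart (map proj₂ (decomp ω)))
Φ₂-runs ω with decomp ω
... | []                = refl
... | (m₀ , n₀) ∷ rest = begin
  concatMap (λ m → ones (m ∸ 1) ++ two ∷ []) (reverse ms) ++ ones m₀ ++ t₂
    ≡⟨ sym (++-assoc (concatMap _ (reverse ms)) (ones m₀) t₂) ⟩
  (concatMap (λ m → ones (m ∸ 1) ++ two ∷ []) (reverse ms) ++ ones m₀) ++ t₂
    ≡⟨ cong (λ x → (x ++ ones m₀) ++ t₂) (sym (concatMap-map (λ k → ones k ++ two ∷ []) (_∸ 1) (reverse ms))) ⟩
  (concatMap (λ k → ones k ++ two ∷ []) (map (_∸ 1) (reverse ms)) ++ ones m₀) ++ t₂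
    ≡⟨ cong (λ x → (concatMap (λ k → ones k ++ two ∷ []) x ++ ones m₀) ++ t₂) (reverse-map (_∸ 1) ms) ⟩
  (concatMap (λ k → ones k ++ two ∷ []) (reverse (map (_∸ 1) ms)) ++ ones m₀) ++ t₂
    ≡⟨ cong (_++ t₂) (row-∷ʳ (two ∷ []) (reverse (map (_∸ 1) ms)) m₀) ⟩
  spell (reverse (map (_∸ 1) ms) ∷ʳ m₀) t₂
    ≡⟨ cong (λ x → spell x t₂) (sym (unfold-reverse m₀ (map (_∸ 1) ms))) ⟩
  spell (reverse (m₀ ∷ map (_∸ 1) ms)) t₂ ∎
  where
  ms = map proj₁ rest
  t₂ = tailPart (n₀ ∷ map proj₂ rest)

at-map : ∀ (f : ℕ → ℕ) → f 0 ≡ 0 → ∀ xs k → at (map f xs) k ≡ f (at xs k)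
at-map f f0 xs       zero          = sym f0
at-map f f0 []       (suc k)       = sym f0
at-map f f0 (x ∷ xs) (suc zero)    = refl
at-map f f0 (x ∷ xs) (suc (suc k)) = at-map f f0 xs (suc k)

at-∷ʳ : ∀ xs (x : ℕ) i → i ≤ length xs → at (xs ∷ʳ x) i ≡ at xs i
at-∷ʳ xs       x zero          _         = refl
at-∷ʳ (y ∷ ys) x (suc zero)    _         = refl
at-∷ʳ (y ∷ ys) x (suc (suc i)) (s≤s le) = at-∷ʳ ys x (suc i) le

at-∷ʳ-last : ∀ xs (x : ℕ) → at (xs ∷ʳ x) (suc (length xs)) ≡ x
at-∷ʳ-last []           x = refl
at-∷ʳ-last (y ∷ [])     x = refl
at-∷ʳ-last (y ∷ z ∷ zs) x = at-∷ʳ-last (z ∷ zs) x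

at-reverse : ∀ xs i j → suc (i + j) ≡ length xs → at (reverse xs) (suc i) ≡ at xs (suc j)
at-reverse (z ∷ zs) i zero e = begin
  at (reverse (z ∷ zs)) (suc i)             ≡⟨ cong (λ r → at r (suc i)) (unfold-reverse z zs) ⟩
  at (reverse zs ∷ʳ z) (suc i)              ≡⟨ cong (λ k → at (reverse zs ∷ʳ z) (suc k)) i≡len ⟩
  at (reverse zs ∷ʳ z) (suc (length (reverse zs))) ≡⟨ at-∷ʳ-last (reverse zs) z ⟩
  z ∎
  where
  i≡len : i ≡ length (reverse zs)
  i≡len = trans (sym (+-identityʳ i)) (trans (suc-injective e) (sym (length-reverse zs)))
at-reverse (z ∷ zs) i (suc j) e = begin
  at (reverse (z ∷ zs)) (suc i)  ≡⟨ cong (λ r → at r (suc i)) (unfold-reverse z zs) ⟩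
  at (reverse zs ∷ʳ z) (suc i)   ≡⟨ at-∷ʳ (reverse zs) z (suc i) i<len ⟩
  at (reverse zs) (suc i)        ≡⟨ at-reverse zs i j e′ ⟩
  at zs (suc j)                  ∎
  where
  e′ : suc (i + j) ≡ length zs
  e′ = trans (sym (+-suc i j)) (suc-injective e)
  i<len : suc i ≤ length (reverse zs)
  i<len = subst (suc i ≤_) (trans e′ (sym (length-reverse zs))) (s≤s (m≤m+n i j))

at-ext : ∀ xs ys → length xs ≡ length ys →
         (∀ i → suc i ≤ length xs → at xs (suc i) ≡ at ys (suc i)) → xs ≡ ys
at-ext []       []       _ _ = refl
at-ext (x ∷ xs) (y ∷ ys) e h =
  cong₂ _∷_ (h 0 (s≤s z≤n)) (at-ext xs ys (suc-injective e) (λ i lt → h (suc i) (s≤s lt)))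

palindrome : ∀ xs → (∀ i j → suc (i + j) ≡ length xs → at xs (suc i) ≡ at xs (suc j)) →
             reverse xs ≡ xs
palindrome xs mirror = at-ext (reverse xs) xs (length-reverse xs) agree
  where
  agree : ∀ i → suc i ≤ length (reverse xs) → at (reverse xs) (suc i) ≡ at xs (suc i)
  agree i lt = trans (at-reverse xs i j e) (sym (mirror i j e))
    where
    j = length xs ∸ suc i
    e : suc (i + j) ≡ length xs
    e = m+[n∸m]≡n (subst (suc i ≤_) (length-reverse xs) lt)

-- The H-condition read on a decomposition; InH ω unfolds to HCondition (decomp ω).
HCondition : List (ℕ × ℕ) → Set
HCondition D = (suc (m 0) ≡ m d) × (∀ i → 1 ≤ i → i ≤ d ∸ 1 → m i ≡ m (d ∸ i))
  where
  d : ℕ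
  d = length (map proj₁ D) ∸ 1
  m : ℕ → ℕ
  m i = at (map proj₁ D) (suc i)

-- Under the H-condition the run vector (m₀, m₁-1, …, m_d-1) is a palindrome:
-- its ends are m₀ = m_d - 1 and its inner entries are mirrored by m_i = m_{d-i}.
runs-palindrome : ∀ D → HCondition D → reverse (runs D) ≡ runs D
runs-palindrome []                  _          = refl
runs-palindrome ((m₀ , _) ∷ rest) (ends , inner) = palindrome R mirror
  where
  ms = map proj₁ rest
  d  = length ms
  R  = m₀ ∷ map (_∸ 1) ms
  M : ℕ → ℕ
  M i = at (m₀ ∷ ms) (suc i)

  R-inner : ∀ i → at R (suc (suc i)) ≡ M (suc i) ∸ 1
  R-inner i = at-map (_∸ 1) refl ms (suc i)

  R-last : ∀ j → suc j ≡ d → at R (suc (suc j)) ≡ m₀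
  R-last j e = trans (R-inner j) (cong (_∸ 1) (sym (subst (λ k → suc m₀ ≡ M k) (sym e) ends)))

  mirror : ∀ i j → suc (i + j) ≡ length R → at R (suc i) ≡ at R (suc j)
  mirror zero    zero    _ = refl
  mirror zero    (suc j) e = sym (R-last j (trans (suc-injective e) (length-map _ ms)))
  mirror (suc i) zero    e = R-last i (trans (sym (+-identityʳ (suc i)))
                                          (trans (suc-injective e) (length-map _ ms)))
  mirror (suc i) (suc j) e = begin
    at R (suc (suc i))            ≡⟨ R-inner i ⟩
    M (suc i) ∸ 1                 ≡⟨ cong (_∸ 1) (inner (suc i) (s≤s z≤n) bound) ⟩
    M (d ∸ suc i) ∸ 1             ≡⟨ cong (λ k → M k ∸ 1) d-i ⟩
    M (suc j) ∸ 1                 ≡⟨ sym (R-inner j) ⟩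
    at R (suc (suc j))            ∎
    where
    i+j=d : suc i + suc j ≡ d
    i+j=d = trans (suc-injective e) (length-map _ ms)
    d-i : d ∸ suc i ≡ suc j
    d-i = trans (cong (_∸ suc i) (sym i+j=d)) (m+n∸m≡n (suc i) (suc j))
    bound : suc i ≤ d ∸ 1
    bound = subst (λ k → suc i ≤ k ∸ 1) i+j=d (subst (suc i ≤_) (sym (+-suc i j)) (s≤s (m≤m+n i j)))

Φ₁⁻¹≡Φ₂-on-H : ∀ ω → InH ω → Φ₁⁻¹ ω ≡ Φ₂ ω
Φ₁⁻¹≡Φ₂-on-H ω h = begin
  Φ₁⁻¹ ω                     ≡⟨ Φ₁⁻¹-runs ω ⟩
  spell (runs D) t₂           ≡⟨ cong (λ r → spell r t₂) (sym (runs-palindrome D h)) ⟩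
  spell (reverse (runs D)) t₂ ≡⟨ sym (Φ₂-runs ω) ⟩
  Φ₂ ω                       ∎
  where
  D = decomp ω
  t₂ = tailPart (map proj₂ D)

gtail : List ℕ → ℕ → Word
gtail []       e = twos e
gtail (k ∷ ks) e = two ∷ one ∷ ones k ++ gtail ks e

-- gword c e: the word 1^{c₀} 2 1^{1+c₁} ⋯ 2 1^{1+c_d} 2^e, whose run vector is c.
-- For e ≤ 1 these are exactly the words without two consecutive 2's.
gword : List ℕ → ℕ → Word
gword []       e = twos e
gword (c ∷ cs) e = ones c ++ gtail cs e

gdec : ℕ → List ℕ → ℕ → List (ℕ × ℕ)
gdec m []       e = (m , e) ∷ []
gdec m (k ∷ ks) e = (m , 1) ∷ gdec (suc k) ks e

dec-ones : ∀ a R m → dec (ones a ++ R) m 0 ≡ dec R (a + m) 0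
dec-ones zero    R m = refl
dec-ones (suc a) R m = trans (dec-ones a R (suc m)) (cong (λ k → dec R k 0) (+-suc a m))

dec-twos : ∀ e m k → dec (twos e) m k ≡ (m , e + k) ∷ []
dec-twos zero    m k = refl
dec-twos (suc e) m k = trans (dec-twos e m (suc k)) (cong (λ j → (m , j) ∷ []) (+-suc e k))

dec-gtail : ∀ ks e m → dec (gtail ks e) m 0 ≡ gdec m ks e
dec-gtail []       e m = trans (dec-twos e m 0) (cong (λ j → (m , j) ∷ []) (+-identityʳ e))
dec-gtail (k ∷ ks) e m = cong ((m , 1) ∷_) (begin
  dec (ones k ++ gtail ks e) 1 0  ≡⟨ dec-ones k (gtail ks e) 1 ⟩
  dec (gtail ks e) (k + 1) 0      ≡⟨ cong (λ j → dec (gtail ks e) j 0) (+-comm k 1) ⟩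
  dec (gtail ks e) (suc k) 0      ≡⟨ dec-gtail ks e (suc k) ⟩
  gdec (suc k) ks e               ∎)

decomp-gword : ∀ c cs e → decomp (gword (c ∷ cs) e) ≡ gdec c cs e
decomp-gword c cs e = begin
  dec (ones c ++ gtail cs e) 0 0  ≡⟨ dec-ones c (gtail cs e) 0 ⟩
  dec (gtail cs e) (c + 0) 0      ≡⟨ cong (λ j → dec (gtail cs e) j 0) (+-identityʳ c) ⟩
  dec (gtail cs e) c 0            ≡⟨ dec-gtail cs e c ⟩
  gdec c cs e                     ∎

runs-gdec : ∀ m ks e → runs (gdec m ks e) ≡ m ∷ ks
runs-gdec m []       e = refl
runs-gdec m (k ∷ ks) e = cong (m ∷_) (later k ks)
  where
  later : ∀ k ks → map (_∸ 1) (map proj₁ (gdec (suc k) ks e)) ≡ k ∷ ks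
  later k []        = refl
  later k (k′ ∷ ks) = cong (k ∷_) (later k′ ks)

tail-gdec : ∀ m ks e → tailPart (map proj₂ (gdec m ks e)) ≡ ones (length ks) ++ twos e
tail-gdec m []            e = refl
tail-gdec m (k ∷ [])      e = refl
tail-gdec m (k ∷ k′ ∷ ks) e = cong (one ∷_) (tail-gdec (suc k) (k′ ∷ ks) e)

-- Φ₁⁻¹ and Φ₂ on G-words (for c = [] the decomposition is [(0,e)], whose run
-- vector (0) spells the empty word just as [] does).
Φ₁⁻¹-gword : ∀ c e → Φ₁⁻¹ (gword c e) ≡ spell c (ones (length c ∸ 1) ++ twos e)
Φ₁⁻¹-gword [] e = trans (Φ₁⁻¹-runs (twos e)) (cong spelled (dec-gtail [] e 0))
  where spelled = λ D → spell (runs D) (tailPart (map proj₂ D))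
Φ₁⁻¹-gword (c ∷ cs) e = begin
  Φ₁⁻¹ (gword (c ∷ cs) e)            ≡⟨ Φ₁⁻¹-runs (gword (c ∷ cs) e) ⟩
  spelled (decomp (gword (c ∷ cs) e)) ≡⟨ cong spelled (decomp-gword c cs e) ⟩
  spelled (gdec c cs e)               ≡⟨ cong₂ spell (runs-gdec c cs e) (tail-gdec c cs e) ⟩
  spell (c ∷ cs) (ones (length cs) ++ twos e) ∎
  where spelled = λ D → spell (runs D) (tailPart (map proj₂ D))

Φ₂-gword : ∀ c e → Φ₂ (gword c e) ≡ spell (reverse c) (ones (length c ∸ 1) ++ twos e)
Φ₂-gword [] e = trans (Φ₂-runs (twos e)) (cong spelled (dec-gtail [] e 0))
  where spelled = λ D → spell (reverse (runs D)) (tailPart (map proj₂ D))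
Φ₂-gword (c ∷ cs) e = begin
  Φ₂ (gword (c ∷ cs) e)               ≡⟨ Φ₂-runs (gword (c ∷ cs) e) ⟩
  spelled (decomp (gword (c ∷ cs) e)) ≡⟨ cong spelled (decomp-gword c cs e) ⟩
  spelled (gdec c cs e)               ≡⟨ cong₂ (spell ∘ reverse) (runs-gdec c cs e) (tail-gdec c cs e) ⟩
  spell (reverse (c ∷ cs)) (ones (length cs) ++ twos e) ∎
  where spelled = λ D → spell (reverse (runs D)) (tailPart (map proj₂ D))

length-gtail : ∀ ks e → length (gtail ks e) ≡ sum ks + length ks + length ks + e
length-gtail []       e = length-replicate e
length-gtail (k ∷ ks) e = begin
  suc (suc (length (ones k ++ gtail ks e)))    ≡⟨ cong (suc ∘ suc) (length-++ (ones k)) ⟩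
  suc (suc (length (ones k) + length (gtail ks e)))
    ≡⟨ cong₂ (λ a b → suc (suc (a + b))) (length-replicate k) (length-gtail ks e) ⟩
  suc (suc (k + (sum ks + length ks + length ks + e)))
    ≡⟨ rearrange k (sum ks) (length ks) e ⟩
  k + sum ks + suc (length ks) + suc (length ks) + e ∎
  where
  rearrange : ∀ k s l e → suc (suc (k + (s + l + l + e))) ≡ k + s + suc l + suc l + e
  rearrange = solve-∀

length-gword : ∀ c e → length (gword c e) ≡ sum c + (length c ∸ 1) + (length c ∸ 1) + e
length-gword []       e = length-replicate e
length-gword (c ∷ cs) e = begin
  length (ones c ++ gtail cs e)                ≡⟨ length-++ (ones c) ⟩
  length (ones c) + length (gtail cs e)        ≡⟨ cong₂ _+_ (length-replicate c) (length-gtail cs e) ⟩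
  c + (sum cs + length cs + length cs + e)     ≡⟨ rearrange c (sum cs) (length cs) e ⟩
  c + sum cs + length cs + length cs + e       ∎
  where
  rearrange : ∀ c s l e → c + (s + l + l + e) ≡ c + s + l + l + e
  rearrange = solve-∀

length-gword-reverse : ∀ c e → length (gword (reverse c) e) ≡ length (gword c e)
length-gword-reverse c e = begin
  length (gword (reverse c) e)                                  ≡⟨ length-gword (reverse c) e ⟩
  sum (reverse c) + (length (reverse c) ∸ 1) + (length (reverse c) ∸ 1) + e
    ≡⟨ cong₂ (λ s l → s + (l ∸ 1) + (l ∸ 1) + e) (sum-↭ (↭-reverse c)) (length-reverse c) ⟩
  sum c + (length c ∸ 1) + (length c ∸ 1) + e                  ≡⟨ sym (length-gword c e) ⟩
  length (gword c e)                                            ∎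

ntt-[] : NoTwoTwos []
ntt-[] ([]    , _ , ())
ntt-[] (_ ∷ _ , _ , ())

ntt-tail : ∀ {x w} → NoTwoTwos (x ∷ w) → NoTwoTwos w
ntt-tail {x} h (xs , ys , eq) = h (x ∷ xs , ys , cong (x ∷_) eq)

ntt-∷ : ∀ {x w} → NoTwoTwos w → (∀ ys → x ∷ w ≢ two ∷ two ∷ ys) → NoTwoTwos (x ∷ w)
ntt-∷ h front ([]     , ys , eq) = front ys eq
ntt-∷ h front (_ ∷ xs , ys , eq) = h (xs , ys , ∷-injectiveʳ eq)

ntt-ones : ∀ k {w} → NoTwoTwos w → NoTwoTwos (ones k ++ w)
ntt-ones zero    h = h
ntt-ones (suc k) h = ntt-∷ (ntt-ones k h) (λ _ ())

ntt-gword : ∀ c {e} → e ≤ 1 → NoTwoTwos (gword c e)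
ntt-gword []       e≤1 = ntt-twos e≤1
  where
  ntt-twos : ∀ {e} → e ≤ 1 → NoTwoTwos (twos e)
  ntt-twos z≤n       = ntt-[]
  ntt-twos (s≤s z≤n) = ntt-∷ ntt-[] (λ _ ())
ntt-gword (c ∷ cs) e≤1 = ntt-ones c (ntt-gtail cs)
  where
  ntt-gtail : ∀ ks → NoTwoTwos (gtail ks _)
  ntt-gtail []       = ntt-gword [] e≤1
  ntt-gtail (k ∷ ks) = ntt-∷ (ntt-∷ (ntt-ones k (ntt-gtail ks)) (λ _ ())) (λ _ ())

record GForm (ω : Word) : Set where
  constructor gform
  field
    first   : ℕ
    others  : List ℕ
    lastRun : ℕ
    lastRun≤1 : lastRun ≤ 1
    shape   : ω ≡ gword (first ∷ others) lastRun

gform-of : ∀ ω → NoTwoTwos ω → GForm ω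
gform-of []                h = gform 0 [] 0 z≤n refl
gform-of (two ∷ [])        h = gform 0 [] 1 (s≤s z≤n) refl
gform-of (two ∷ two ∷ w)   h = ⊥-elim (h ([] , w , refl))
gform-of (one ∷ w)         h with gform-of w (ntt-tail h)
... | gform c cs e e≤1 refl = gform (suc c) cs e e≤1 refl
gform-of (two ∷ one ∷ w)   h with gform-of w (ntt-tail (ntt-tail h))
... | gform c cs e e≤1 refl = gform 0 (c ∷ cs) e e≤1 refl

image-⊆ : ∀ {Ψ Ψ′ : Word → Word} {S : Word → Set} →
          (∀ u → S u → Σ Word (λ v → S v × Ψ′ v ≡ Ψ u)) →
          ∀ w → InImage Ψ S w → InImage Ψ′ S w
image-⊆ hit w (u , su , refl) = hit u su

G-swap : ∀ {n u} → InG n u → Σ Word (λ v → InG n v × Φ₁⁻¹ v ≡ Φ₂ u × Φ₂ v ≡ Φ₁⁻¹ u)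
G-swap (len , ntt) with gform-of _ ntt
... | gform c₀ cs e e≤1 refl =
  gword (reverse c) e ,
  (trans (length-gword-reverse c e) len , ntt-gword (reverse c) e≤1) ,
  (begin
    Φ₁⁻¹ (gword (reverse c) e)           ≡⟨ Φ₁⁻¹-gword (reverse c) e ⟩
    spell (reverse c) (ones (length (reverse c) ∸ 1) ++ twos e)
      ≡⟨ cong (λ l → spell (reverse c) (ones (l ∸ 1) ++ twos e)) (length-reverse c) ⟩
    spell (reverse c) (ones (length c ∸ 1) ++ twos e) ≡⟨ sym (Φ₂-gword c e) ⟩
    Φ₂ (gword c e)                        ∎) ,
  (begin
    Φ₂ (gword (reverse c) e)              ≡⟨ Φ₂-gword (reverse c) e ⟩
    spell (reverse (reverse c)) (ones (length (reverse c) ∸ 1) ++ twos e)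
      ≡⟨ cong₂ (λ r l → spell r (ones (l ∸ 1) ++ twos e)) (reverse-involutive c) (length-reverse c) ⟩
    spell c (ones (length c ∸ 1) ++ twos e) ≡⟨ sym (Φ₁⁻¹-gword c e) ⟩
    Φ₁⁻¹ (gword c e)                      ∎)
  where c = c₀ ∷ cs

Φ₂-Φ₁⁻¹-images : ∀ n → SameImage Φ₂ Φ₁⁻¹ (InG n)
Φ₂-Φ₁⁻¹-images n w =
  image-⊆ (λ u g → let (v , gv , e , _) = G-swap g in v , gv , e) w ,
  image-⊆ (λ u g → let (v , gv , _ , e) = G-swap g in v , gv , e) w

<ᵇ-true : ∀ {a b} → a < b → (a <ᵇ b) ≡ true
<ᵇ-true lt = Equivalence.to T-≡ (<⇒<ᵇ lt)

<ᵇ-false : ∀ {a b} → b ≤ a → (a <ᵇ b) ≡ false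
<ᵇ-false {a} {b} b≤a with a <ᵇ b | <ᵇ-reflects-< a b
... | false | _      = refl
... | true  | ofʸ lt = ⊥-elim (<⇒≱ lt b≤a)

≤ᵇ-true : ∀ {a b} → a ≤ b → (a ≤ᵇ b) ≡ true
≤ᵇ-true le = Equivalence.to T-≡ (≤⇒≤ᵇ le)

≤ᵇ-false : ∀ {a b} → b < a → (a ≤ᵇ b) ≡ false
≤ᵇ-false {a} {b} b<a with a ≤ᵇ b | ≤ᵇ-reflects-≤ a b
... | false | _      = refl
... | true  | ofʸ le = ⊥-elim (<⇒≱ b<a le)

¬T⇒false : ∀ {b} → ¬ T b → b ≡ false
¬T⇒false {false} _  = refl
¬T⇒false {true}  ¬t = ⊥-elim (¬t _)

from-applyUpTo : ∀ a r → from a r ≡ applyUpTo (λ i → a + suc i) r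
from-applyUpTo a r = map-upTo (λ i → a + suc i) r

at-applyUpTo : ∀ (f : ℕ → ℕ) r i → i < r → at (applyUpTo f r) (suc i) ≡ f i
at-applyUpTo f (suc r) zero    _         = refl
at-applyUpTo f (suc r) (suc i) (s≤s lt) = at-applyUpTo (f ∘ suc) r i lt

tabulate-word : ∀ (f : ℕ → L) xs → (∀ i → i < length xs → f i ≡ letterAt xs i) →
                applyUpTo f (length xs) ≡ xs
tabulate-word f []       _ = refl
tabulate-word f (x ∷ xs) h = cong₂ _∷_ (h 0 z<s) (tabulate-word (f ∘ suc) xs (λ i lt → h (suc i) (s<s lt)))

letterAt-++ˡ : ∀ (xs ys : Word) i → i < length xs → letterAt (xs ++ ys) i ≡ letterAt xs i
letterAt-++ˡ (x ∷ xs) ys zero    _         = refl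
letterAt-++ˡ (x ∷ xs) ys (suc i) (s≤s lt) = letterAt-++ˡ xs ys i lt

letterAt-++ʳ : ∀ (xs ys : Word) i → letterAt (xs ++ ys) (length xs + i) ≡ letterAt ys i
letterAt-++ʳ []       ys i = refl
letterAt-++ʳ (x ∷ xs) ys i = letterAt-++ʳ xs ys i

lookupKey-invariant : ∀ {A : Set} (P : ℕ → A → Set) (d : A) xs v →
  All (λ kv → P (proj₁ kv) (proj₂ kv)) xs → Any (λ kv → proj₁ kv ≡ v) xs → P v (lookupKey d xs v)
lookupKey-invariant P d ((k , a) ∷ xs) v (pa ∷ ps) occ with k ≡ᵇ v in eq | occ
... | true  | _          = subst (λ z → P z a) (≡ᵇ⇒≡ k v (Equivalence.from T-≡ eq)) pa
... | false | here k≡v   = ⊥-elim (subst T eq (≡⇒≡ᵇ k v k≡v))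
... | false | there occ′ = lookupKey-invariant P d xs v ps occ′

isOne isTwo : L → Bool
isOne b = val b ≡ᵇ 1
isTwo b = val b ≡ᵇ 2

count-take-suc : ∀ P xs j → j < length xs → P (letterAt xs j) ≡ true →
                     count P (take' (suc j) xs) ≡ suc (count P (take' j xs))
count-take-suc P (x ∷ xs) zero    _         e rewrite e = refl
count-take-suc P (x ∷ xs) (suc j) (s≤s lt) e with P x
... | true  = cong suc (count-take-suc P xs j lt e)
... | false = count-take-suc P xs j lt e

count-take-mono : ∀ P xs {j k} → j ≤ k → count P (take' j xs) ≤ count P (take' k xs)
count-take-mono P xs       {zero}  _         = z≤n
count-take-mono P []       {suc j} (s≤s _)  = z≤n
count-take-mono P (x ∷ xs) {suc j} (s≤s le) with P x
... | true  = s≤s (count-take-mono P xs le)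
... | false = count-take-mono P xs le

count-take-≤ : ∀ P xs j → count P (take' j xs) ≤ count P xs
count-take-≤ P xs       zero    = z≤n
count-take-≤ P []       (suc j) = z≤n
count-take-≤ P (x ∷ xs) (suc j) with P x
... | true  = s≤s (count-take-≤ P xs j)
... | false = count-take-≤ P xs j

-- Discrete intermediate values: every value 1 … count P xs is reached by the
-- prefix counts exactly at a position where P holds.
count-take-hits : ∀ P xs v → 1 ≤ v → v ≤ count P xs →
  Σ ℕ (λ j → j < length xs × P (letterAt xs j) ≡ true × count P (take' (suc j) xs) ≡ v)
count-take-hits P []       v 1≤v v≤0 = ⊥-elim (<⇒≱ 1≤v v≤0)
count-take-hits P (x ∷ xs) v 1≤v v≤c with P x in px
count-take-hits P (x ∷ xs) (suc zero)    _ _          | true = 0 , z<s , px , refl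
count-take-hits P (x ∷ xs) (suc (suc v)) _ (s≤s v≤c) | true
  with count-take-hits P xs (suc v) (s≤s z≤n) v≤c
... | j , lt , e , c = suc j , s<s lt , e , cong suc c
count-take-hits P (x ∷ xs) v 1≤v v≤c | false with count-take-hits P xs v 1≤v v≤c
... | j , lt , e , c = suc j , s<s lt , e , c

count-ones+twos : ∀ xs → count isOne xs + count isTwo xs ≡ length xs
count-ones+twos []         = refl
count-ones+twos (one ∷ xs) = cong suc (count-ones+twos xs)
count-ones+twos (two ∷ xs) = trans (+-suc _ _) (cong suc (count-ones+twos xs))

rank : Word → L → ℕ → ℕ
rank u a i = count (λ b → val b <ᵇ val a) u + count (λ b → val b ≡ᵇ val a) (take' i u)

β-one : ∀ u j → letterAt u j ≡ one → β u (suc j) ≡ count isOne (take' (suc j) u)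
β-one u j e = begin
  β u (suc j)               ≡⟨ cong (λ a → rank u a (suc j)) e ⟩
  rank u one (suc j)        ≡⟨ cong (_+ count isOne (take' (suc j) u)) (none-below-one u) ⟩
  count isOne (take' (suc j) u) ∎
  where
  none-below-one : ∀ xs → count (λ b → val b <ᵇ 1) xs ≡ 0
  none-below-one []         = refl
  none-below-one (one ∷ xs) = none-below-one xs
  none-below-one (two ∷ xs) = none-below-one xs

β-two : ∀ u j → letterAt u j ≡ two → β u (suc j) ≡ count isOne u + count isTwo (take' (suc j) u)
β-two u j e = begin
  β u (suc j)               ≡⟨ cong (λ a → rank u a (suc j)) e ⟩
  rank u two (suc j)        ≡⟨ cong (_+ count isTwo (take' (suc j) u)) (below-two u) ⟩
  count isOne u + count isTwo (take' (suc j) u) ∎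
  where
  below-two : ∀ xs → count (λ b → val b <ᵇ 2) xs ≡ count isOne xs
  below-two []         = refl
  below-two (one ∷ xs) = cong suc (below-two xs)
  below-two (two ∷ xs) = below-two xs

map-oneTo : ∀ {A : Set} (g : ℕ → A) r → map g (oneTo r) ≡ applyUpTo (g ∘ suc) r
map-oneTo g r = trans (sym (map-∘ (upTo r))) (map-upTo (g ∘ suc) r)

All-oneTo : ∀ {A : Set} {P : A → Set} (g : ℕ → A) r → (∀ i → i < r → P (g (suc i))) → All P (map g (oneTo r))
All-oneTo {P = P} g r h = subst (All P) (sym (map-oneTo g r)) (All.applyUpTo⁺₁ (g ∘ suc) r (h _))

Any-oneTo : ∀ {A : Set} {P : A → Set} (g : ℕ → A) r i → i < r → P (g (suc i)) → Any P (map g (oneTo r))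
Any-oneTo {P = P} g r i lt p = subst (Any P) (sym (map-oneTo g r)) (Any.applyUpTo⁺ (g ∘ suc) p lt)

stepKey-descent : ∀ π k m → k < m → m ≤ length π → at π m < at π k → stepKey π k ≡ at π (suc k)
stepKey-descent π k m k<m m≤len smaller = if-cong (Equivalence.to T-≡ (Any.any⁺ _ later))
  where
  i = m ∸ suc k
  k+1+i≡m : k + suc i ≡ m
  k+1+i≡m = trans (+-suc k i) (m+[n∸m]≡n k<m)
  i<rest : i < length π ∸ k
  i<rest = subst (_≤ length π ∸ k) (m+n∸m≡n k (suc i))
             (∸-monoˡ-≤ k (subst (_≤ length π) (sym k+1+i≡m) m≤len))
  later : Any (T ∘ (λ m → at π m <ᵇ at π k)) (from k (length π ∸ k))
  later = subst (Any _) (sym (from-applyUpTo k _))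
            (Any.applyUpTo⁺ (λ i → k + suc i) (subst (λ m → T (at π m <ᵇ at π k)) (sym k+1+i≡m) (<⇒<ᵇ smaller)) i<rest)

stepKey-ascent : ∀ π k → (∀ m → k < m → m ≤ length π → at π k ≤ at π m) →
                 stepKey π k ≡ at π (suc (lastBelow π (at π k) (k ∸ 1)))
stepKey-ascent π k larger = if-cong (¬T⇒false noLater)
  where
  noLater : ¬ T (any (λ m → at π m <ᵇ at π k) (from k (length π ∸ k)))
  noLater t with Any.applyUpTo⁻ (λ i → k + suc i) (subst (Any _) (from-applyUpTo k _) (Any.any⁻ _ _ t))
  ... | i , i<rest , smaller = <⇒≱ (<ᵇ⇒< _ _ smaller) (larger (k + suc i) k<m m≤len)
    where
    k<len : k < length π
    k<len = m∸n≢0⇒n<m (λ eq → <⇒≱ (subst (i <_) eq i<rest) z≤n)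
    k<m : k < k + suc i
    k<m = subst (k <_) (sym (+-suc k i)) (s≤s (m≤m+n k i))
    m≤len : k + suc i ≤ length π
    m≤len = subst (k + suc i ≤_) (m+[n∸m]≡n (<⇒≤ k<len)) (+-monoʳ-≤ k i<rest)

lastBelow-hit : ∀ π v i → at π (suc i) < v → lastBelow π v (suc i) ≡ suc i
lastBelow-hit π v i lt = if-cong (<ᵇ-true lt)

lastBelow-skip : ∀ π v i → v ≤ at π (suc i) → lastBelow π v (suc i) ≡ lastBelow π v i
lastBelow-skip π v i le = if-cong (<ᵇ-false le)

lastBelow-stop : ∀ π v i → (∀ {i′} → i ≡ suc i′ → at π (suc i′) < v) → lastBelow π v i ≡ i
lastBelow-stop π v zero    _ = refl
lastBelow-stop π v (suc i) h = lastBelow-hit π v i (h refl)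

before₁ : L → Word → Word
before₁ prev []        = []
before₁ prev (one ∷ w) = prev ∷ before₁ one w
before₁ prev (two ∷ w) = before₁ two w

after₂ : Word → Word
after₂ []            = []
after₂ (one ∷ w)     = after₂ w
after₂ (two ∷ [])    = two ∷ []
after₂ (two ∷ x ∷ w) = one ∷ after₂ (x ∷ w)

length-before₁ : ∀ prev w → length (before₁ prev w) ≡ count isOne w
length-before₁ prev []        = refl
length-before₁ prev (one ∷ w) = cong suc (length-before₁ one w)
length-before₁ prev (two ∷ w) = length-before₁ two w

length-after₂ : ∀ w → length (after₂ w) ≡ count isTwo w
length-after₂ []            = refl
length-after₂ (one ∷ w)     = length-after₂ w
length-after₂ (two ∷ [])    = refl
length-after₂ (two ∷ x ∷ w) = cong suc (length-after₂ (x ∷ w))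

before₁-at : ∀ prev w j → j < length w → letterAt w j ≡ one →
             letterAt (before₁ prev w) (count isOne (take' j w)) ≡ letterAt (prev ∷ w) j
before₁-at prev (one ∷ w) zero    _         _ = refl
before₁-at prev (one ∷ w) (suc j) (s≤s lt) e = before₁-at one w j lt e
before₁-at prev (two ∷ w) (suc j) (s≤s lt) e = before₁-at two w j lt e

after₂-inner : ∀ w j → suc j < length w → letterAt w j ≡ two →
               letterAt (after₂ w) (count isTwo (take' j w)) ≡ one
after₂-inner (one ∷ w)     (suc j) (s≤s lt) e = after₂-inner w j lt e
after₂-inner (two ∷ [])    zero    (s≤s ()) _
after₂-inner (two ∷ x ∷ w) zero    _         _ = refl
after₂-inner (two ∷ x ∷ w) (suc j) (s≤s lt) e = after₂-inner (x ∷ w) j lt e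

after₂-last : ∀ w j → suc j ≡ length w → letterAt w j ≡ two →
              letterAt (after₂ w) (count isTwo (take' j w)) ≡ two
after₂-last (one ∷ w)     (suc j) eq e = after₂-last w j (suc-injective eq) e
after₂-last (two ∷ [])    zero    _  _ = refl
after₂-last (two ∷ x ∷ w) (suc j) eq e = after₂-last (x ∷ w) j (suc-injective eq) e

before₁-twos : ∀ prev e → before₁ prev (twos e) ≡ []
before₁-twos prev zero    = refl
before₁-twos prev (suc e) = before₁-twos two e

before₁-ones : ∀ k w → before₁ one (ones k ++ w) ≡ ones k ++ before₁ one w
before₁-ones zero    w = refl
before₁-ones (suc k) w = cong (one ∷_) (before₁-ones k w)

after₂-ones : ∀ k w → after₂ (ones k ++ w) ≡ after₂ w
after₂-ones zero    w = refl
after₂-ones (suc k) w = after₂-ones k w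

TwoThenOne : Word → Set
TwoThenOne u = ∀ j → suc j < length u → letterAt u j ≡ two → letterAt u (suc j) ≡ one

two-then-one : ∀ {u} → NoTwoTwos u → TwoThenOne u
two-then-one {two ∷ one ∷ w} h zero    _         _  = refl
two-then-one {two ∷ two ∷ w} h zero    _         _  = ⊥-elim (h ([] , w , refl))
two-then-one {one ∷ _ ∷ _}   h zero    _         ()
two-then-one {_ ∷ []}        h zero    (s≤s ()) _
two-then-one {x ∷ w}         h (suc j) (s≤s lt) e  = two-then-one (ntt-tail h) j lt e

module Analysis (u : Word) (two-one : TwoThenOne u) where

  n p : ℕ
  n = length u
  p = count isOne u

  U : ℕ → L
  U = letterAt u

  ones-before twos-before : ℕ → ℕ
  ones-before j = count isOne (take' j u)
  twos-before j = count isTwo (take' j u)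

  π : List ℕ
  π = standardize u

  letter-cases : ∀ x → x ≡ one ⊎ x ≡ two
  letter-cases one = inj₁ refl
  letter-cases two = inj₂ refl

  one-before-two : ∀ i → suc i < n → U (suc i) ≡ two → U i ≡ one
  one-before-two i lt e with U i in eq
  ... | one = refl
  ... | two with () ← trans (sym (two-one i lt eq)) e

  value-one : ∀ j → j < n → U j ≡ one → β u (suc j) ≡ suc (ones-before j)
  value-one j lt e = trans (β-one u j e) (count-take-suc isOne u j lt (cong isOne e))

  value-two : ∀ j → j < n → U j ≡ two → β u (suc j) ≡ p + suc (twos-before j)
  value-two j lt e = trans (β-two u j e) (cong (p +_) (count-take-suc isTwo u j lt (cong isTwo e)))

  one≤p : ∀ j → U j ≡ one → β u (suc j) ≤ p
  one≤p j e = subst (_≤ p) (sym (β-one u j e)) (count-take-≤ isOne u (suc j))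

  one<two : ∀ i j → j < n → U i ≡ one → U j ≡ two → β u (suc i) < β u (suc j)
  one<two i j lt ei ej = ≤-<-trans (one≤p i ei) (subst (p <_) (sym (value-two j lt ej)) (m<m+n p z<s))

  ones-increase : ∀ i j → i < j → j < n → U i ≡ one → U j ≡ one → β u (suc i) < β u (suc j)
  ones-increase i j i<j j<n ei ej =
    ≤-<-trans (subst (_≤ ones-before j) (sym (β-one u i ei)) (count-take-mono isOne u i<j))
              (subst (ones-before j <_) (sym (value-one j j<n ej)) (n<1+n (ones-before j)))

  one-below-later : ∀ i m → i < m → m < n → U i ≡ one → β u (suc i) ≤ β u (suc m)
  one-below-later i m i<m m<n ei with letter-cases (U m)
  ... | inj₁ em = <⇒≤ (ones-increase i m i<m m<n ei em)
  ... | inj₂ em = <⇒≤ (one<two i m m<n ei em)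

  π-length : length π ≡ n
  π-length = trans (cong length (map-oneTo (β u) n)) (length-applyUpTo _ n)

  π-at : ∀ j → j < n → at π (suc j) ≡ β u (suc j)
  π-at j lt = trans (cong (λ xs → at xs (suc j)) (map-oneTo (β u) n)) (at-applyUpTo _ n j lt)

  β-onto : ∀ i → i < n → Σ ℕ (λ m → m < n × β u (suc m) ≡ suc i)
  β-onto i i<n with suc i ≤? p
  ... | yes i<p with count-take-hits isOne u (suc i) (s≤s z≤n) i<p
  ...   | m , m<n , e , c = m , m<n , trans (β-one u m (isOne⇒one e)) c
    where
    isOne⇒one : ∀ {x} → isOne x ≡ true → x ≡ one
    isOne⇒one {one} _ = refl
  β-onto i i<n | no i≮p with count-take-hits isTwo u (suc i ∸ p) (m<n⇒0<n∸m p<i) in-range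
    where
    p<i : p < suc i
    p<i = ≰⇒> i≮p
    in-range : suc i ∸ p ≤ count isTwo u
    in-range = subst (suc i ∸ p ≤_) (m+n∸m≡n p (count isTwo u))
                 (∸-monoˡ-≤ p (subst (suc i ≤_) (sym (count-ones+twos u)) i<n))
  ... | m , m<n , e , c = m , m<n , (begin
    β u (suc m)                          ≡⟨ β-two u m (isTwo⇒two e) ⟩
    p + count isTwo (take' (suc m) u)   ≡⟨ cong (p +_) c ⟩
    p + (suc i ∸ p)                     ≡⟨ m+[n∸m]≡n (<⇒≤ (≰⇒> i≮p)) ⟩
    suc i                               ∎)
    where
    isTwo⇒two : ∀ {x} → isTwo x ≡ true → x ≡ two
    isTwo⇒two {two} _ = refl

  data Kind : ℕ → Set where
    one-first     : U 0 ≡ one → Kind 0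
    one-after-one : ∀ {i} → U (suc i) ≡ one → U i ≡ one → Kind (suc i)
    one-after-two : ∀ {i} → U (suc i) ≡ one → U i ≡ two → Kind (suc i)
    two-inner     : ∀ {j} → suc j < n → U j ≡ two → Kind j
    two-last      : ∀ {j} → suc j ≡ n → U j ≡ two → Kind j

  kind : ∀ j → j < n → Kind j
  kind j lt with letter-cases (U j)
  kind zero    lt | inj₁ e = one-first e
  kind (suc i) lt | inj₁ e with letter-cases (U i)
  ... | inj₁ e′ = one-after-one e e′
  ... | inj₂ e′ = one-after-two e e′
  kind j lt | inj₂ e with suc j <? n
  ... | yes inner = two-inner inner e
  ... | no  last  = two-last (≤-antisym lt (≮⇒≥ last)) e

  -- partner j: a 2 followed by a letter is paired with that letter, a 1 preceded
  -- by a 2 with that 2, and every other position with itself.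
  partner-after : ℕ → L → ℕ
  partner-after i one = suc i
  partner-after i two = i

  partner-by : L → ℕ → ℕ
  partner-by one zero    = zero
  partner-by one (suc i) = partner-after i (U i)
  partner-by two j       = if suc j <ᵇ n then suc j else j

  partner : ℕ → ℕ
  partner j = partner-by (U j) j

  partner-one-first : U 0 ≡ one → partner 0 ≡ 0
  partner-one-first e = cong (λ x → partner-by x 0) e

  partner-one-after : ∀ i x → U (suc i) ≡ one → U i ≡ x → partner (suc i) ≡ partner-after i x
  partner-one-after i x e e′ = trans (cong (λ y → partner-by y (suc i)) e) (cong (partner-after i) e′)

  partner-two-inner : ∀ j → suc j < n → U j ≡ two → partner j ≡ suc j
  partner-two-inner j lt e = trans (cong (λ x → partner-by x j) e) (if-cong (<ᵇ-true lt))

  partner-two-last : ∀ j → suc j ≡ n → U j ≡ two → partner j ≡ j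
  partner-two-last j eq e = trans (cong (λ x → partner-by x j) e) (if-cong (<ᵇ-false (≤-reflexive (sym eq))))

  partner-< : ∀ j → j < n → partner j < n
  partner-< j lt with kind j lt
  ... | one-first e         = subst (_< n) (sym (partner-one-first e)) lt
  ... | one-after-one e e′  = subst (_< n) (sym (partner-one-after _ one e e′)) lt
  ... | one-after-two e e′  = subst (_< n) (sym (partner-one-after _ two e e′)) (<-trans (n<1+n _) lt)
  ... | two-inner inner e   = subst (_< n) (sym (partner-two-inner j inner e)) inner
  ... | two-last last e     = subst (_< n) (sym (partner-two-last j last e)) lt

  partner-involutive : ∀ j → j < n → partner (partner j) ≡ j
  partner-involutive j lt with kind j lt
  ... | one-first e        = trans (cong partner (partner-one-first e)) (partner-one-first e)
  ... | one-after-one e e′ = trans (cong partner fixed) fixed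
    where fixed = partner-one-after _ one e e′
  ... | one-after-two {i} e e′ = trans (cong partner (partner-one-after i two e e′)) (partner-two-inner i lt e′)
  ... | two-inner inner e  = trans (cong partner (partner-two-inner j inner e))
                                   (partner-one-after j two (two-one j inner e) e)
  ... | two-last last e    = trans (cong partner fixed) fixed
    where fixed = partner-two-last j last e

  -- Step j+1 of φ (where π_{j+1} = β(j+1)) assigns its value to the key β(partner j + 1).
  -- A 2 followed by a 1 is in case (1) of φ; every other position is in case (2),
  -- where the backward scan stops at the nearest earlier 1 of smaller value.
  ascent : ∀ j → j < n → (∀ m → j < m → m < n → β u (suc j) ≤ β u (suc m)) →
           stepKey π (suc j) ≡ at π (suc (lastBelow π (β u (suc j)) j))
  ascent j lt larger = trans (stepKey-ascent π (suc j) larger′)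
                             (cong (λ v → at π (suc (lastBelow π v j))) (π-at j lt))
    where
    larger′ : ∀ m → suc j < m → m ≤ length π → at π (suc j) ≤ at π m
    larger′ (suc m) (s≤s j<m) m<len =
      subst₂ _≤_ (sym (π-at j lt)) (sym (π-at m m<n)) (larger m j<m m<n)
      where m<n = subst (suc m ≤_) π-length m<len

  ascent-one : ∀ j → j < n → U j ≡ one → stepKey π (suc j) ≡ at π (suc (lastBelow π (β u (suc j)) j))
  ascent-one j lt e = ascent j lt (λ m j<m m<n → one-below-later j m j<m m<n e)

  key-one-first : 0 < n → U 0 ≡ one → stepKey π 1 ≡ β u (suc (partner 0))
  key-one-first lt e = begin
    stepKey π 1            ≡⟨ ascent-one 0 lt e ⟩
    at π 1                 ≡⟨ π-at 0 lt ⟩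
    β u 1                  ≡⟨ cong (β u ∘ suc) (sym (partner-one-first e)) ⟩
    β u (suc (partner 0))  ∎

  key-one-after-one : ∀ i → suc i < n → U (suc i) ≡ one → U i ≡ one →
                      stepKey π (suc (suc i)) ≡ β u (suc (partner (suc i)))
  key-one-after-one i lt e e′ = begin
    stepKey π (suc (suc i))             ≡⟨ ascent-one (suc i) lt e ⟩
    at π (suc (lastBelow π v (suc i)))  ≡⟨ cong (at π ∘ suc) (lastBelow-hit π v i smaller) ⟩
    at π (suc (suc i))                  ≡⟨ π-at (suc i) lt ⟩
    β u (suc (suc i))                   ≡⟨ cong (β u ∘ suc) (sym (partner-one-after i one e e′)) ⟩
    β u (suc (partner (suc i)))         ∎
    where
    v = β u (suc (suc i))
    smaller : at π (suc i) < v
    smaller = subst (_< v) (sym (π-at i (<-trans (n<1+n i) lt))) (ones-increase i (suc i) (n<1+n i) lt e′ e)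

  key-one-after-two : ∀ i → suc i < n → U (suc i) ≡ one → U i ≡ two →
                      stepKey π (suc (suc i)) ≡ β u (suc (partner (suc i)))
  key-one-after-two i lt e e′ = begin
    stepKey π (suc (suc i))             ≡⟨ ascent-one (suc i) lt e ⟩
    at π (suc (lastBelow π v (suc i)))  ≡⟨ cong (at π ∘ suc) (lastBelow-skip π v i not-smaller) ⟩
    at π (suc (lastBelow π v i))        ≡⟨ cong (at π ∘ suc) (lastBelow-stop π v i earlier-one) ⟩
    at π (suc i)                        ≡⟨ π-at i i<n ⟩
    β u (suc i)                         ≡⟨ cong (β u ∘ suc) (sym (partner-one-after i two e e′)) ⟩
    β u (suc (partner (suc i)))         ∎
    where
    v = β u (suc (suc i))
    i<n = <-trans (n<1+n i) lt
    not-smaller : v ≤ at π (suc i)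
    not-smaller = subst (v ≤_) (sym (π-at i i<n)) (<⇒≤ (one<two (suc i) i i<n e e′))
    earlier-one : ∀ {i′} → i ≡ suc i′ → at π (suc i′) < v
    earlier-one refl = subst (_< v) (sym (π-at _ (<-trans (n<1+n _) i<n)))
      (ones-increase _ (suc i) (<-trans (n<1+n _) (n<1+n _)) lt (one-before-two _ i<n e′) e)

  key-two-inner : ∀ j → suc j < n → U j ≡ two → stepKey π (suc j) ≡ β u (suc (partner j))
  key-two-inner j inner e = begin
    stepKey π (suc j)       ≡⟨ stepKey-descent π (suc j) (suc (suc j)) (n<1+n (suc j)) next-in smaller ⟩
    at π (suc (suc j))      ≡⟨ π-at (suc j) inner ⟩
    β u (suc (suc j))       ≡⟨ cong (β u ∘ suc) (sym (partner-two-inner j inner e)) ⟩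
    β u (suc (partner j))   ∎
    where
    lt = <-trans (n<1+n j) inner
    next-in : suc (suc j) ≤ length π
    next-in = subst (suc (suc j) ≤_) (sym π-length) inner
    smaller : at π (suc (suc j)) < at π (suc j)
    smaller = subst₂ _<_ (sym (π-at (suc j) inner)) (sym (π-at j lt))
                (one<two (suc j) j lt (two-one j inner e) e)

  key-two-last : ∀ j → suc j ≡ n → U j ≡ two → stepKey π (suc j) ≡ β u (suc (partner j))
  key-two-last j last e = begin
    stepKey π (suc j)             ≡⟨ ascent j lt nothing-later ⟩
    at π (suc (lastBelow π v j))  ≡⟨ cong (at π ∘ suc) (lastBelow-stop π v j earlier-one) ⟩
    at π (suc j)                  ≡⟨ π-at j lt ⟩
    β u (suc j)                   ≡⟨ cong (β u ∘ suc) (sym (partner-two-last j last e)) ⟩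
    β u (suc (partner j))         ∎
    where
    v = β u (suc j)
    lt = subst (j <_) last (n<1+n j)
    nothing-later : ∀ m → j < m → m < n → v ≤ β u (suc m)
    nothing-later m j<m m<n = ⊥-elim (<⇒≱ m<n (subst (_≤ m) last j<m))
    earlier-one : ∀ {i′} → j ≡ suc i′ → at π (suc i′) < v
    earlier-one refl = subst (_< v) (sym (π-at _ (<-trans (n<1+n _) lt)))
      (one<two _ j lt (one-before-two _ lt e) e)

  stepKey-partner : ∀ j → j < n → stepKey π (suc j) ≡ β u (suc (partner j))
  stepKey-partner j lt with kind j lt
  ... | one-first e            = key-one-first lt e
  ... | one-after-one {i} e e′ = key-one-after-one i lt e e′
  ... | one-after-two {i} e e′ = key-one-after-two i lt e e′
  ... | two-inner inner e      = key-two-inner j inner e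
  ... | two-last last e        = key-two-last j last e

  AB : Word
  AB = before₁ one u ++ after₂ u

  left-neighbour : ∀ j → j < n → U j ≡ one → letterAt (one ∷ u) j ≡ U (partner j)
  left-neighbour j lt e with kind j lt
  ... | one-first e₀        = trans (sym e₀) (cong U (sym (partner-one-first e₀)))
  ... | one-after-one e₀ e′ = trans e′ (trans (sym e₀) (cong U (sym (partner-one-after _ one e₀ e′))))
  ... | one-after-two e₀ e′ = cong U (sym (partner-one-after _ two e₀ e′))
  ... | two-inner _ e₂      with () ← trans (sym e) e₂
  ... | two-last _ e₂       with () ← trans (sym e) e₂

  right-context : ∀ j → j < n → U j ≡ two → letterAt (after₂ u) (twos-before j) ≡ U (partner j)
  right-context j lt e with suc j <? n
  ... | yes inner = trans (after₂-inner u j inner e)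
                      (trans (sym (two-one j inner e)) (cong U (sym (partner-two-inner j inner e))))
  ... | no ¬inner = trans (after₂-last u j last e) (trans (sym e) (cong U (sym (partner-two-last j last e))))
    where last = ≤-antisym lt (≮⇒≥ ¬inner)

  AB-at : ∀ j → j < n → letterAt AB (β u (suc j) ∸ 1) ≡ U (partner j)
  AB-at j lt with letter-cases (U j)
  ... | inj₁ e = begin
    letterAt AB (β u (suc j) ∸ 1)            ≡⟨ cong (λ v → letterAt AB (v ∸ 1)) (value-one j lt e) ⟩
    letterAt AB (ones-before j)               ≡⟨ letterAt-++ˡ (before₁ one u) (after₂ u) _ in-before ⟩
    letterAt (before₁ one u) (ones-before j)  ≡⟨ before₁-at one u j lt e ⟩
    letterAt (one ∷ u) j                      ≡⟨ left-neighbour j lt e ⟩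
    U (partner j)                             ∎
    where
    in-before : ones-before j < length (before₁ one u)
    in-before = subst (ones-before j <_) (sym (length-before₁ one u))
                  (subst (_≤ p) (value-one j lt e) (one≤p j e))
  ... | inj₂ e = begin
    letterAt AB (β u (suc j) ∸ 1)                        ≡⟨ cong (λ v → letterAt AB (v ∸ 1)) (value-two j lt e) ⟩
    letterAt AB (p + suc (twos-before j) ∸ 1)            ≡⟨ cong (letterAt AB) past-before ⟩
    letterAt AB (length (before₁ one u) + twos-before j) ≡⟨ letterAt-++ʳ (before₁ one u) (after₂ u) _ ⟩
    letterAt (after₂ u) (twos-before j)                  ≡⟨ right-context j lt e ⟩
    U (partner j)                                        ∎
    where
    past-before : p + suc (twos-before j) ∸ 1 ≡ length (before₁ one u) + twos-before j
    past-before = trans (cong (_∸ 1) (+-suc p _)) (cong (_+ twos-before j) (sym (length-before₁ one u)))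

  letter-of : ℕ → L
  letter-of v = if v ≤ᵇ p then one else two

  letter-of-β : ∀ j → j < n → letter-of (β u (suc j)) ≡ U j
  letter-of-β j lt with letter-cases (U j)
  ... | inj₁ e = trans (if-cong (≤ᵇ-true (one≤p j e))) (sym e)
  ... | inj₂ e = trans (if-cong (≤ᵇ-false (subst (p <_) (sym (value-two j lt e)) (m<m+n p z<s)))) (sym e)

  assignments : List (ℕ × ℕ)
  assignments = map (λ k → (stepKey π k , at π k)) (oneTo (length π))

  table : List (ℕ × L)
  table = map (λ j → (β u j , letterAt u (j ∸ 1))) (oneTo n)

  Decodes : ℕ → ℕ → Set
  Decodes key val = letterAt AB (key ∸ 1) ≡ letter-of val × Σ ℕ (λ m → m < n × val ≡ β u (suc m))

  φ-at : ∀ i → i < n → Decodes (suc i) (lookupKey 0 assignments (suc i))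
  φ-at i i<n = lookupKey-invariant Decodes 0 assignments (suc i) (All-oneTo _ (length π) entry) key-occurs
    where
    entry : ∀ j → j < length π → Decodes (stepKey π (suc j)) (at π (suc j))
    entry j j<len = decoded , j , j<n , π-at j j<n
      where
      j<n = subst (j <_) π-length j<len
      decoded : letterAt AB (stepKey π (suc j) ∸ 1) ≡ letter-of (at π (suc j))
      decoded = begin
        letterAt AB (stepKey π (suc j) ∸ 1)       ≡⟨ cong (λ k → letterAt AB (k ∸ 1)) (stepKey-partner j j<n) ⟩
        letterAt AB (β u (suc (partner j)) ∸ 1)   ≡⟨ AB-at (partner j) (partner-< j j<n) ⟩
        U (partner (partner j))                   ≡⟨ cong U (partner-involutive j j<n) ⟩
        U j                                       ≡⟨ sym (letter-of-β j j<n) ⟩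
        letter-of (β u (suc j))                   ≡⟨ cong letter-of (sym (π-at j j<n)) ⟩
        letter-of (at π (suc j))                  ∎
    key-occurs : Any (λ kv → proj₁ kv ≡ suc i) assignments
    key-occurs with β-onto i i<n
    ... | m , m<n , e = Any-oneTo _ (length π) (partner m) (subst (partner m <_) (sym π-length) (partner-< m m<n))
      (begin
        stepKey π (suc (partner m))       ≡⟨ stepKey-partner (partner m) (partner-< m m<n) ⟩
        β u (suc (partner (partner m)))   ≡⟨ cong (β u ∘ suc) (partner-involutive m m<n) ⟩
        β u (suc m)                       ≡⟨ e ⟩
        suc i                             ∎)

  table-at : ∀ j → j < n → lookupKey one table (β u (suc j)) ≡ letter-of (β u (suc j))
  table-at j j<n = sym (lookupKey-invariant (λ key val → letter-of key ≡ val) one table (β u (suc j))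
                          (All-oneTo _ n letter-of-β) (Any-oneTo _ n j j<n refl))

  length-AB : length AB ≡ n
  length-AB = begin
    length (before₁ one u ++ after₂ u)                ≡⟨ length-++ (before₁ one u) ⟩
    length (before₁ one u) + length (after₂ u)        ≡⟨ cong₂ _+_ (length-before₁ one u) (length-after₂ u) ⟩
    count isOne u + count isTwo u                     ≡⟨ count-ones+twos u ⟩
    n                                                 ∎

  Γ≡AB : Γ u ≡ AB
  Γ≡AB = begin
    Γ u ≡⟨⟩
    map (lookupKey one table) (map (lookupKey 0 assignments) (oneTo (length π)))
      ≡⟨ cong (map (lookupKey one table)) (map-oneTo (lookupKey 0 assignments) (length π)) ⟩
    map (lookupKey one table) (applyUpTo (lookupKey 0 assignments ∘ suc) (length π))
      ≡⟨ map-applyUpTo _ (lookupKey one table) (length π) ⟩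
    applyUpTo letter (length π)
      ≡⟨ cong (applyUpTo letter) (trans π-length (sym length-AB)) ⟩
    applyUpTo letter (length AB)
      ≡⟨ tabulate-word letter AB (λ i lt → Γ-at i (subst (i <_) length-AB lt)) ⟩
    AB ∎
    where
    letter : ℕ → L
    letter i = lookupKey one table (lookupKey 0 assignments (suc i))
    Γ-at : ∀ i → i < n → letter i ≡ letterAt AB i
    Γ-at i i<n with φ-at i i<n
    ... | decoded , m , m<n , stored = trans (cong (lookupKey one table) stored)
                                         (trans (table-at m m<n) (sym (trans decoded (cong letter-of stored))))

-- On a G-word the two context words spell out Φ₁⁻¹: the 1's see the run vector
-- separated by 2's, the 2's see d inner 1's and the final run 2^e.
before₁-gword : ∀ c e → before₁ one (gword c e) ≡ row (two ∷ []) c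
before₁-gword []       e = before₁-twos one e
before₁-gword (c ∷ cs) e = trans (before₁-ones c (gtail cs e)) (cong (ones c ++_) (inner one cs))
  where
  inner : ∀ prev ks → before₁ prev (gtail ks e) ≡ concatMap (λ k → two ∷ ones k) ks
  inner prev []       = before₁-twos prev e
  inner prev (k ∷ ks) = cong (two ∷_) (trans (before₁-ones k (gtail ks e)) (cong (ones k ++_) (inner one ks)))

after₂-gword : ∀ c {e} → e ≤ 1 → after₂ (gword c e) ≡ ones (length c ∸ 1) ++ twos e
after₂-gword []       e≤1 = last-run e≤1
  where
  last-run : ∀ {e} → e ≤ 1 → after₂ (twos e) ≡ twos e
  last-run z≤n       = refl
  last-run (s≤s z≤n) = refl
after₂-gword (c ∷ cs) e≤1 = trans (after₂-ones c (gtail cs _)) (inner cs)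
  where
  inner : ∀ ks → after₂ (gtail ks _) ≡ ones (length ks) ++ twos _
  inner []       = after₂-gword [] e≤1
  inner (k ∷ ks) = cong (one ∷_) (trans (after₂-ones k (gtail ks _)) (inner ks))

Φ₁⁻¹-contexts : ∀ u → NoTwoTwos u → Φ₁⁻¹ u ≡ before₁ one u ++ after₂ u
Φ₁⁻¹-contexts u h with gform-of u h
... | gform c cs e e≤1 refl =
  trans (Φ₁⁻¹-gword (c ∷ cs) e)
        (sym (cong₂ _++_ (before₁-gword (c ∷ cs) e) (after₂-gword (c ∷ cs) e≤1)))

Γ≡Φ₁⁻¹ : ∀ u → NoTwoTwos u → Γ u ≡ Φ₁⁻¹ u
Γ≡Φ₁⁻¹ u h = trans (Analysis.Γ≡AB u (two-then-one h)) (sym (Φ₁⁻¹-contexts u h))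

Φ₁⁻¹-Γ-images : ∀ n → SameImage Φ₁⁻¹ Γ (InG n)
Φ₁⁻¹-Γ-images n w =
  image-⊆ (λ u g → u , g , Γ≡Φ₁⁻¹ u (proj₂ g)) w ,
  image-⊆ (λ u g → u , g , sym (Γ≡Φ₁⁻¹ u (proj₂ g))) w

theorem4p1 : (∀ (n : ℕ) → 1 ≤ n →
                SameImage Φ₂ Φ₁⁻¹ (InG n) × SameImage Φ₁⁻¹ Γ (InG n))
             × (∀ (ω : Word) → InH ω → Φ₁⁻¹ ω ≡ Φ₂ ω)
theorem4p1 = (λ n _ → Φ₂-Φ₁⁻¹-images n , Φ₁⁻¹-Γ-images n) , Φ₁⁻¹≡Φ₂-on-H
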